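{- Let $\mathcal{P}_n$ be an ordered partition of $\{0,1\}^n$ into colour classes, and let $S_n := \{k\in[n] \mid \{k\} \text{ is a part of } \mathcal{Q}_n\}$, where $\mathcal{Q}_n$ is the intersection of the partitions $\mathbf{SP}(C)$ for all $C\in\mathcal{P}_n$, i.e.\ $\mathcal{Q}_n=\{\bigcap_{C\in\mathcal{P}_n}\mathbf{SP}(C)(k) \mid k\in[n]\}$. Let $c$ be a constant such that for every colour class $C \in \mathcal{P}_n$, for large enough $n$, $|C| \leq c \cdot n$. Further, assume that every element of $\{0,1\}^n$ occurs in at least one $C \in \mathcal{P}_n$. Then, for all large enough $n$: $|[n] \setminus S_n| < 8\log n$.
   Context: $\mathbf{Sym}_n$ acts on $\{0,1\}^n$ by permuting positions: $\pi(v) = v_{\pi^{ -1}(1)}\cdots v_{\pi^{ -1}(n)}$, and this extends to sets of strings. For $C\subseteq\{0,1\}^n$, $\mathbf{SP}(C)$ is the coarsest partition $\mathcal{P}$ of $[n]$ such that every $\pi\in\mathbf{Sym}_n$ fixing each part of $\mathcal{P}$ setwise stabilises $C$. For a partition $\mathcal{P}$ and $k\in[n]$, $\mathcal{P}(k)$ is the part containing $k$. -}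

module Defs where

open import Data.Bool using (Bool; true; false; not; _∨_)
open import Data.Nat using (ℕ; zero; suc; _≡ᵇ_; _<_; _≤_; _*_; _^_)
open import Data.Fin using (Fin)
import Data.Fin as Fin
open import Data.Vec using (Vec; []; _∷_; tabulate; lookup)
open import Data.List using (List; []; _∷_; [_]; map; _++_; filterᵇ; length; allFin; concatMap)
open import Data.Bool.ListAction using (and)
open import Data.List.Relation.Unary.Any using (Any)
open import Data.List.Membership.Propositional using (_∈_)
open import Data.Fin.Permutation using (Permutation′; _⟨$⟩ʳ_; _⟨$⟩ˡ_)
open import Data.Product using (Σ; ∃; _×_; _,_)
open import Relation.Binary.PropositionalEquality using (_≡_; _≢_)
open import Relation.Nullary using (¬_)

Str : ℕ → Set
Str n = Vec Bool n

StrSet : ℕ → Set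
StrSet n = Str n → Bool

allStrings : (n : ℕ) → List (Str n)
allStrings zero = [ [] ]
allStrings (suc n) = map (true ∷_) (allStrings n) ++ map (false ∷_) (allStrings n)

card : {n : ℕ} → StrSet n → ℕ
card {n} C = length (filterᵇ C (allStrings n))

-- π(v) = v_{π⁻¹(1)} ... v_{π⁻¹(n)}
act : {n : ℕ} → Permutation′ n → Str n → Str n
act π v = tabulate (λ i → lookup v (π ⟨$⟩ˡ i))

-- π stabilises C, i.e. π(C) = C  (w ∈ π(C) iff π⁻¹(w) ∈ C)
Stabilises : {n : ℕ} → Permutation′ n → StrSet n → Set
Stabilises π C = ∀ w → C (act π w) ≡ C w

-- A partition of [n] is represented by a block labelling p : Fin n → ℕ;
-- i and j lie in the same part iff p i ≡ p j.
Partition : ℕ → Set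
Partition n = Fin n → ℕ

FixesParts : {n : ℕ} → Permutation′ n → Partition n → Set
FixesParts π p = ∀ i → p (π ⟨$⟩ʳ i) ≡ p i

Respects : {n : ℕ} → StrSet n → Partition n → Set
Respects C p = ∀ π → FixesParts π p → Stabilises π C

Refines : {n : ℕ} → Partition n → Partition n → Set
Refines q p = ∀ i j → q i ≡ q j → p i ≡ p j

IsSP : {n : ℕ} → StrSet n → Partition n → Set
IsSP C p = Respects C p × (∀ q → Respects C q → Refines q p)

IsOrderedPartition : {n : ℕ} → List (StrSet n) → Set
IsOrderedPartition {n} P =
  (∀ C → C ∈ P → ∃ λ (v : Str n) → C v ≡ true) ×
  (∀ (i j : Fin (length P)) → i ≢ j → ∀ (v : Str n) →
     ¬ (Data.List.lookup P i v ≡ true × Data.List.lookup P j v ≡ true))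

-- Given SP-labellings sp C for the classes C of P:
-- k and l are in the same part of Q = ⋂_{C∈P} SP(C)
sameQ : {n : ℕ} → List (StrSet n) → (StrSet n → Partition n) → Fin n → Fin n → Bool
sameQ P sp k l = and (map (λ C → sp C k ≡ᵇ sp C l) P)

inS : {n : ℕ} → List (StrSet n) → (StrSet n → Partition n) → Fin n → Bool
inS {n} P sp k = and (map (λ l → (Fin.toℕ l ≡ᵇ Fin.toℕ k) ∨ not (sameQ P sp k l)) (allFin n))

cardNotS : {n : ℕ} → List (StrSet n) → (StrSet n → Partition n) → ℕ
cardNotS {n} P sp = length (filterᵇ (λ k → not (inS P sp k)) (allFin n))

{-# OPTIONS --safe #-}
-- Call two positions Q-equivalent if they lie in the same part of Q. Greedily
-- match Q-equivalent positions into m disjoint pairs (a , b). A position outside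
-- S is either matched or Q-equivalent to a distinct matched position, so
-- |[n] ∖ S| ≤ 4m. Swapping a and b fixes every part of every SP(C), hence
-- stabilises every colour class. Starting from a string that is 1 at every a and
-- 0 at every b, the 2^m strings obtained by swapping any subset of the pairs are
-- distinct and all lie in one class C, so 2^|[n] ∖ S| ≤ |C|^4 ≤ (cn)^4 < n^8 once
-- n > c.
module Submission where

open import Defs
open import Level using (_⊔_)
open import Function using (_∘_; id; case_of_)
open import Function.Bundles using (Equivalence)
open import Data.Bool using (Bool; true; false; not; T; _∨_)
open import Data.Bool.Properties using (T-≡; T-not-≡)
open import Data.Nat using (ℕ; suc; _≤_; _<_; _*_; _^_; _+_; _≡ᵇ_; z≤n; s≤s; >-nonZero)
import Data.Nat as ℕ
open import Data.Nat.Properties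
  using (m<n⇒0<n; ^-monoˡ-≤; ^-monoʳ-≤; ^-monoˡ-<; *-monoˡ-<; ^-*-assoc; *-comm;
         *-identityʳ; +-identityʳ; *-distribˡ-+; *-distribʳ-+; ≡ᵇ⇒≡; ≡⇒≡ᵇ; m⊔n≤o⇒m≤o; m⊔n≤o⇒n≤o; module ≤-Reasoning)
open import Data.Fin using (Fin; toℕ; _≟_)
open import Data.Fin.Permutation using (Permutation′; _⟨$⟩ʳ_; transpose; flip; inverseˡ)
import Data.Fin.Permutation.Components as PC
open import Data.Vec using ([]; _∷_; tabulate; lookup)
open import Data.Vec.Properties using (lookup∘tabulate; tabulate∘lookup; tabulate-cong)
open import Data.List using (List; []; _∷_; _++_; map; length; filterᵇ; allFin)
open import Data.List.Properties using (length-++; length-map)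
open import Data.List.Relation.Unary.Any using (Any; here; there; any?)
open import Data.List.Relation.Unary.All as All using (All; []; _∷_)
open import Data.List.Relation.Unary.All.Properties using (++⁻ˡ; ¬Any⇒All¬; All¬⇒¬Any; ¬All⇒Any¬; all⁺; all⁻)
open import Data.List.Relation.Unary.AllPairs using ([]; _∷_)
open import Data.List.Relation.Unary.Unique.Propositional using (Unique)
import Data.List.Relation.Unary.Unique.Propositional.Properties as Unique
import Data.List.Relation.Binary.Permutation.Setoid.Properties as PermutationSetoid
open import Data.List.Relation.Binary.Permutation.Propositional
  using (_↭_; ↭-sym; ↭-refl; ↭-prep; ↭-swap; ↭⇒↭ₛ; module PermutationReasoning)
open import Data.List.Relation.Binary.Permutation.Propositional.Properties
  using (∈-resp-↭; ↭-length; shift; ++⁺ˡ)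
open import Data.List.Membership.Propositional using (_∈_; _∉_; find)
open import Data.List.Membership.Propositional.Properties
  using (∈-∃++; ∈-++⁻; ∈-++⁺ˡ; ∈-++⁺ʳ; ∈-map⁺; ∈-map⁻; ∈-filter⁺; ∈-filter⁻; ∈-allFin)
import Data.List.Membership.DecPropositional as DecMembership
open import Data.Product using (∃; _×_; _,_; proj₁; proj₂; uncurry)
open import Data.Sum using (_⊎_; inj₁; inj₂)
import Data.Sum as Sum
open import Data.Unit using (tt)
open import Relation.Binary using (Decidable; Symmetric; Transitive)
open import Relation.Binary.PropositionalEquality
  using (_≡_; _≢_; refl; sym; trans; cong; cong₂; subst; setoid; module ≡-Reasoning)
open import Relation.Nullary using (¬_; yes; no; does; contradiction)
open import Relation.Nullary.Decidable using (T?; dec-true; dec-false)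

∈⇒↭∷ : ∀ {a} {A : Set a} {x : A} {xs} → x ∈ xs → ∃ λ ys → xs ↭ x ∷ ys
∈⇒↭∷ x∈xs with h , t , refl ← ∈-∃++ x∈xs = h ++ t , shift _ h t

module _ {a} {A : Set a} where

  Unique-++⁻ˡ : ∀ (xs : List A) {ys} → Unique (xs ++ ys) → Unique xs
  Unique-++⁻ˡ []       _            = []
  Unique-++⁻ˡ (x ∷ xs) (x∉ ∷ xs++ys!) = ++⁻ˡ xs x∉ ∷ Unique-++⁻ˡ xs xs++ys!

  length-≤-injection : ∀ {b} {B : Set b} {xs : List A} {ys : List B} → Unique xs →
                       (f : ∀ {x} → x ∈ xs → B) →
                       (∀ {x y} (x∈ : x ∈ xs) (y∈ : y ∈ xs) → f x∈ ≡ f y∈ → x ≡ y) →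
                       (∀ {x} (x∈ : x ∈ xs) → f x∈ ∈ ys) →
                       length xs ≤ length ys
  length-≤-injection {xs = []} _ _ _ _ = z≤n
  length-≤-injection {xs = x ∷ xs} {ys} (x∉xs ∷ xs!) f f-inj f∈ys
    with ys′ , ys↭ ← ∈⇒↭∷ (f∈ys (here refl)) = begin
      suc (length xs)  ≤⟨ s≤s (length-≤-injection xs! (f ∘ there) (λ p q → f-inj (there p) (there q)) f∈ys′) ⟩
      suc (length ys′) ≡⟨ ↭-length ys↭ ⟨
      length ys        ∎
    where
      open ≤-Reasoning
      f∈ys′ : ∀ {y} (y∈xs : y ∈ xs) → f (there y∈xs) ∈ ys′
      f∈ys′ y∈xs with ∈-resp-↭ ys↭ (f∈ys (there y∈xs))
      ... | here eq = contradiction (sym (f-inj (there y∈xs) (here refl) eq)) (All.lookup x∉xs y∈xs)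
      ... | there y∈ys′ = y∈ys′

  Unique-⊆⇒length-≤ : {xs ys : List A} → Unique xs → (∀ {x} → x ∈ xs → x ∈ ys) → length xs ≤ length ys
  Unique-⊆⇒length-≤ xs! xs⊆ys = length-≤-injection xs! (λ {x} _ → x) (λ _ _ → id) xs⊆ys

  endpoints : List (A × A) → List A
  endpoints []             = []
  endpoints ((x , y) ∷ ps) = x ∷ y ∷ endpoints ps

  length-endpoints : ∀ ps → length (endpoints ps) ≡ 2 * length ps
  length-endpoints []       = refl
  length-endpoints (_ ∷ ps) = trans (cong (2 +_) (length-endpoints ps)) (sym (*-distribˡ-+ 2 1 (length ps)))

  ∈-endpoints : ∀ {x y ps} → (x , y) ∈ ps → x ∈ endpoints ps × y ∈ endpoints ps
  ∈-endpoints (here refl) = here refl , there (here refl)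
  ∈-endpoints {ps = _ ∷ _} (there xy∈ps) with x∈ , y∈ ← ∈-endpoints xy∈ps = there (there x∈) , there (there y∈)

  firsts⊆endpoints : ∀ {x ps} → x ∈ map proj₁ ps → x ∈ endpoints ps
  firsts⊆endpoints x∈F with _ , xy∈ps , refl ← ∈-map⁻ proj₁ x∈F = proj₁ (∈-endpoints xy∈ps)

  second∉firsts : ∀ {x y ps} → Unique (endpoints ps) → (x , y) ∈ ps → y ∉ map proj₁ ps
  second∉firsts ((x≢y ∷ _) ∷ _)  (here refl)   (here y≡x)  = x≢y (sym y≡x)
  second∉firsts (_ ∷ y∉E ∷ _)    (here refl)   (there y∈F) = All.lookup y∉E (firsts⊆endpoints y∈F) refl
  second∉firsts ((_ ∷ x∉E) ∷ _)  (there xy∈ps) (here refl) = All.lookup x∉E (proj₂ (∈-endpoints xy∈ps)) refl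
  second∉firsts (_ ∷ _ ∷ E!)     (there xy∈ps) (there y∈F) = second∉firsts E! xy∈ps y∈F

module GreedyMatching {a r} {A : Set a} {R : A → A → Set r} (R? : Decidable R) (R-sym : Symmetric R) where

  record Matching (xs : List A) : Set (a ⊔ r) where
    field
      pairs                 : List (A × A)
      unmatched             : List A
      pairs-related         : All (uncurry R) pairs
      partition             : endpoints pairs ++ unmatched ↭ xs
      unmatched-independent : ∀ {x y} → x ∈ unmatched → y ∈ unmatched → R x y → x ≡ y

  open Matching

  emptyMatching : Matching []
  emptyMatching = record
    { pairs = [] ; unmatched = [] ; pairs-related = [] ; partition = ↭-refl
    ; unmatched-independent = λ () }

  insert : ∀ {xs} → Matching xs → (k : A) → Matching (k ∷ xs)
  insert {xs} M k with any? (λ p → R? p k) (unmatched M)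
  ... | yes k~unmatched with p , p∈ , p~k ← find k~unmatched with rest , unmatched↭ ← ∈⇒↭∷ p∈ = record
    { pairs = (p , k) ∷ pairs M
    ; unmatched = rest
    ; pairs-related = p~k ∷ pairs-related M
    ; partition = begin
        p ∷ k ∷ (endpoints (pairs M) ++ rest)    ↭⟨ ↭-swap p k ↭-refl ⟩
        k ∷ (p ∷ endpoints (pairs M) ++ rest)    ↭⟨ ↭-prep k (↭-sym (shift p (endpoints (pairs M)) rest)) ⟩
        k ∷ (endpoints (pairs M) ++ p ∷ rest)    ↭⟨ ↭-prep k (++⁺ˡ (endpoints (pairs M)) (↭-sym unmatched↭)) ⟩
        k ∷ (endpoints (pairs M) ++ unmatched M) ↭⟨ ↭-prep k (partition M) ⟩
        k ∷ xs                                   ∎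
    ; unmatched-independent = λ x∈ y∈ → unmatched-independent M (shrink x∈) (shrink y∈)
    }
    where
      open PermutationReasoning
      shrink : ∀ {x} → x ∈ rest → x ∈ unmatched M
      shrink x∈ = ∈-resp-↭ (↭-sym unmatched↭) (there x∈)
  ... | no ¬k~unmatched = record
    { pairs = pairs M
    ; unmatched = k ∷ unmatched M
    ; pairs-related = pairs-related M
    ; partition = begin
        endpoints (pairs M) ++ k ∷ unmatched M   ↭⟨ shift k (endpoints (pairs M)) (unmatched M) ⟩
        k ∷ (endpoints (pairs M) ++ unmatched M) ↭⟨ ↭-prep k (partition M) ⟩
        k ∷ xs                                   ∎
    ; unmatched-independent = independent
    }
    where
      open PermutationReasoning
      k≁unmatched : All (λ p → ¬ R p k) (unmatched M)
      k≁unmatched = ¬Any⇒All¬ (unmatched M) ¬k~unmatched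
      independent : ∀ {x y} → x ∈ k ∷ unmatched M → y ∈ k ∷ unmatched M → R x y → x ≡ y
      independent (here refl) (here refl) _   = refl
      independent (here refl) (there y∈)  k~y = contradiction (R-sym k~y) (All.lookup k≁unmatched y∈)
      independent (there x∈)  (here refl) x~k = contradiction x~k (All.lookup k≁unmatched x∈)
      independent (there x∈)  (there y∈)  x~y = unmatched-independent M x∈ y∈ x~y

  greedyMatching : (xs : List A) → Matching xs
  greedyMatching []       = emptyMatching
  greedyMatching (x ∷ xs) = insert (greedyMatching xs) x

  HasPartner : List A → A → Set (a ⊔ r)
  HasPartner xs t = ∃ λ u → u ∈ xs × u ≢ t × R t u

  -- Matched positions are counted once as themselves and unmatched ones through
  -- their partner, which must be matched and determines them by independence.
  length-partnered≤4*pairs : Transitive R → ∀ {xs ts} (M : Matching xs) → Unique ts →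
                             (∀ {t} → t ∈ ts → t ∈ xs) → (∀ {t} → t ∈ ts → HasPartner xs t) →
                             length ts ≤ 4 * length (pairs M)
  length-partnered≤4*pairs R-trans {xs} {ts} M ts! ts⊆xs partner = begin
    length ts                                 ≤⟨ length-≤-injection ts! code code-injective code∈ ⟩
    length (map inj₁ E ++ map inj₂ E)         ≡⟨ length-++ (map inj₁ E) ⟩
    length (map inj₁ E) + length (map inj₂ E) ≡⟨ cong₂ _+_ (length-map inj₁ E) (length-map inj₂ E) ⟩
    length E + length E                       ≡⟨ cong (λ l → l + l) (length-endpoints (pairs M)) ⟩
    2 * m + 2 * m                             ≡⟨ *-distribʳ-+ m 2 2 ⟨
    4 * m                                     ∎
    where
      open ≤-Reasoning
      E = endpoints (pairs M)
      m = length (pairs M)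

      position : ∀ {x} → x ∈ xs → x ∈ E ⊎ x ∈ unmatched M
      position x∈ = ∈-++⁻ E (∈-resp-↭ (↭-sym (partition M)) x∈)

      partner-matched : ∀ {t u} → t ∈ unmatched M → u ∈ xs → u ≢ t → R t u → u ∈ E
      partner-matched t∈ u∈ u≢t t~u with position u∈
      ... | inj₁ u∈E = u∈E
      ... | inj₂ u∈unmatched = contradiction (sym (unmatched-independent M t∈ u∈unmatched t~u)) u≢t

      code : ∀ {t} → t ∈ ts → A ⊎ A
      code {t} t∈ = Sum.map (λ _ → t) (λ _ → proj₁ (partner t∈)) (position (ts⊆xs t∈))

      code∈ : ∀ {t} (t∈ : t ∈ ts) → code t∈ ∈ map inj₁ E ++ map inj₂ E
      code∈ t∈ with position (ts⊆xs t∈) | partner t∈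
      ... | inj₁ t∈E         | _ = ∈-++⁺ˡ (∈-map⁺ inj₁ t∈E)
      ... | inj₂ t∈unmatched | u , u∈ , u≢t , t~u =
        ∈-++⁺ʳ (map inj₁ E) (∈-map⁺ inj₂ (partner-matched t∈unmatched u∈ u≢t t~u))

      code-injective : ∀ {x y} (x∈ : x ∈ ts) (y∈ : y ∈ ts) → code x∈ ≡ code y∈ → x ≡ y
      code-injective x∈ y∈ eq with position (ts⊆xs x∈) | position (ts⊆xs y∈) | partner x∈ | partner y∈ | eq
      ... | inj₁ _  | inj₁ _  | _ | _ | refl = refl
      ... | inj₂ x∈unmatched | inj₂ y∈unmatched | u , _ , _ , x~u | .u , _ , _ , y~u | refl =
        unmatched-independent M x∈unmatched y∈unmatched (R-trans x~u (R-sym y~u))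

∈-allStrings : ∀ {n} (w : Str n) → w ∈ allStrings n
∈-allStrings []                = here refl
∈-allStrings {suc n} (true ∷ w)  = ∈-++⁺ˡ (∈-map⁺ (true ∷_) (∈-allStrings w))
∈-allStrings {suc n} (false ∷ w) = ∈-++⁺ʳ (map (true ∷_) (allStrings n)) (∈-map⁺ (false ∷_) (∈-allStrings w))

module _ {n : ℕ} where

  transpose-fixes : ∀ {i j k : Fin n} → k ≢ i → k ≢ j → PC.transpose i j k ≡ k
  transpose-fixes {i} {j} {k} k≢i k≢j with k ≟ i
  ... | yes k≡i = contradiction k≡i k≢i
  ... | no _ with k ≟ j
  ...   | yes k≡j = contradiction k≡j k≢j
  ...   | no _    = refl

  transpose-second : ∀ (i j : Fin n) → PC.transpose i j j ≡ i
  transpose-second i j with j ≟ i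
  ... | yes j≡i = j≡i
  ... | no _ with j ≟ j
  ...   | yes _   = refl
  ...   | no j≢j  = contradiction refl j≢j

  transpose-fixesParts : ∀ (p : Partition n) {i j} → p i ≡ p j → FixesParts (transpose i j) p
  transpose-fixesParts p {i} {j} pi≡pj k with k ≟ i
  ... | yes refl = sym pi≡pj
  ... | no _ with k ≟ j
  ...   | yes refl = pi≡pj
  ...   | no _     = refl

  act-flip-act : ∀ (π : Permutation′ n) (w : Str n) → act (flip π) (act π w) ≡ w
  act-flip-act π w = trans
    (tabulate-cong λ i → trans (lookup∘tabulate _ (π ⟨$⟩ʳ i)) (cong (lookup w) (inverseˡ π)))
    (tabulate∘lookup w)

  act-injective : ∀ (π : Permutation′ n) {w w′ : Str n} → act π w ≡ act π w′ → w ≡ w′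
  act-injective π {w} {w′} eq = begin
    w                      ≡⟨ act-flip-act π w ⟨
    act (flip π) (act π w)  ≡⟨ cong (act (flip π)) eq ⟩
    act (flip π) (act π w′) ≡⟨ act-flip-act π w′ ⟩
    w′                     ∎
    where open ≡-Reasoning

  swapAt : Fin n → Fin n → Str n → Str n
  swapAt i j = act (transpose i j)

  lookup-swapAt : ∀ i j (w : Str n) x → lookup (swapAt i j w) x ≡ lookup w (PC.transpose j i x)
  lookup-swapAt i j w x = lookup∘tabulate _ x

  swapClosure : Str n → List (Fin n × Fin n) → List (Str n)
  swapClosure v []             = v ∷ []
  swapClosure v ((i , j) ∷ ps) = swapClosure v ps ++ map (swapAt i j) (swapClosure v ps)

  length-swapClosure : ∀ v ps → length (swapClosure v ps) ≡ 2 ^ length ps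
  length-swapClosure v []             = refl
  length-swapClosure v ((i , j) ∷ ps) = begin
    length (ws ++ map (swapAt i j) ws)       ≡⟨ length-++ ws ⟩
    length ws + length (map (swapAt i j) ws) ≡⟨ cong (length ws +_) (length-map (swapAt i j) ws) ⟩
    length ws + length ws                    ≡⟨ cong (λ l → l + l) (length-swapClosure v ps) ⟩
    2 ^ length ps + 2 ^ length ps            ≡⟨ cong (2 ^ length ps +_) (+-identityʳ (2 ^ length ps)) ⟨
    2 ^ suc (length ps)                      ∎
    where
      open ≡-Reasoning
      ws = swapClosure v ps

  swapClosure-agrees : ∀ {v ps w x} → w ∈ swapClosure v ps → x ∉ endpoints ps → lookup w x ≡ lookup v x
  swapClosure-agrees {ps = []} (here refl) _ = refl
  swapClosure-agrees {v} {(i , j) ∷ ps} {x = x} w∈ x∉ with ∈-++⁻ (swapClosure v ps) w∈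
  ... | inj₁ w∈ws = swapClosure-agrees w∈ws (x∉ ∘ there ∘ there)
  ... | inj₂ w∈swapped with w′ , w′∈ws , refl ← ∈-map⁻ (swapAt i j) w∈swapped = begin
    lookup (swapAt i j w′) x     ≡⟨ lookup-swapAt i j w′ x ⟩
    lookup w′ (PC.transpose j i x) ≡⟨ cong (lookup w′) (transpose-fixes (x∉ ∘ there ∘ here) (x∉ ∘ here)) ⟩
    lookup w′ x                  ≡⟨ swapClosure-agrees w′∈ws (x∉ ∘ there ∘ there) ⟩
    lookup v x                   ∎
    where open ≡-Reasoning

  Separates : Str n → Fin n × Fin n → Set
  Separates v (i , j) = lookup v i ≢ lookup v j

  swapClosure-unique : ∀ v ps → Unique (endpoints ps) → All (Separates v) ps → Unique (swapClosure v ps)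
  swapClosure-unique v []             _ _ = [] ∷ []
  swapClosure-unique v ((i , j) ∷ ps) ((i≢j ∷ i∉E) ∷ j∉E ∷ E!) (vi≢vj ∷ separated) =
    Unique.++⁺ ws! (Unique.map⁺ (act-injective (transpose i j)) ws!) disjoint
    where
      ws! = swapClosure-unique v ps E! separated
      disjoint : ∀ {w} → ¬ (w ∈ swapClosure v ps × w ∈ map (swapAt i j) (swapClosure v ps))
      disjoint (w∈ws , w∈swapped) with w′ , w′∈ws , refl ← ∈-map⁻ (swapAt i j) w∈swapped =
        vi≢vj (begin
          lookup v i                     ≡⟨ swapClosure-agrees w∈ws (All¬⇒¬Any i∉E) ⟨
          lookup (swapAt i j w′) i       ≡⟨ lookup-swapAt i j w′ i ⟩
          lookup w′ (PC.transpose j i i) ≡⟨ cong (lookup w′) (transpose-second j i) ⟩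
          lookup w′ j                    ≡⟨ swapClosure-agrees w′∈ws (All¬⇒¬Any j∉E) ⟩
          lookup v j                     ∎)
        where open ≡-Reasoning

  StableUnderSwap : StrSet n → Fin n × Fin n → Set
  StableUnderSwap C (i , j) = Stabilises (transpose i j) C

  swapClosure-⊆ : ∀ {C : StrSet n} {v ps w} → All (StableUnderSwap C) ps →
                  C v ≡ true → w ∈ swapClosure v ps → C w ≡ true
  swapClosure-⊆ {ps = []} _ Cv (here refl) = Cv
  swapClosure-⊆ {C} {v} {(i , j) ∷ ps} (stable ∷ stables) Cv w∈ with ∈-++⁻ (swapClosure v ps) w∈
  ... | inj₁ w∈ws = swapClosure-⊆ stables Cv w∈ws
  ... | inj₂ w∈swapped with w′ , w′∈ws , refl ← ∈-map⁻ (swapAt i j) w∈swapped =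
    trans (stable w′) (swapClosure-⊆ stables Cv w′∈ws)

  2^length≤card : ∀ {C : StrSet n} {v ps} → Unique (endpoints ps) → All (Separates v) ps →
                  All (StableUnderSwap C) ps → C v ≡ true →
                  2 ^ length ps ≤ card C
  2^length≤card {C} {v} {ps} E! separated stables Cv = begin
    2 ^ length ps             ≡⟨ length-swapClosure v ps ⟨
    length (swapClosure v ps) ≤⟨ Unique-⊆⇒length-≤ (swapClosure-unique v ps E! separated) ∈C ⟩
    card C                    ∎
    where
      open ≤-Reasoning
      ∈C : ∀ {w} → w ∈ swapClosure v ps → w ∈ filterᵇ C (allStrings n)
      ∈C {w} w∈ = ∈-filter⁺ (T? ∘ C) (∈-allStrings w) (Equivalence.from T-≡ (swapClosure-⊆ stables Cv w∈))

  markFirsts : List (Fin n × Fin n) → Str n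
  markFirsts ps = tabulate λ x → does (x ∈? map proj₁ ps)
    where open DecMembership _≟_ using (_∈?_)

  markFirsts-separates : ∀ ps → Unique (endpoints ps) → All (Separates (markFirsts ps)) ps
  markFirsts-separates ps E! = All.tabulate λ {(i , j)} ij∈ps vi≡vj →
    case trans (sym (marked (∈-map⁺ proj₁ ij∈ps))) (trans vi≡vj (unmarked (second∉firsts E! ij∈ps))) of λ ()
    where
      open DecMembership _≟_ using (_∈?_)
      marked : ∀ {x} → x ∈ map proj₁ ps → lookup (markFirsts ps) x ≡ true
      marked {x} x∈ = trans (lookup∘tabulate _ x) (dec-true (x ∈? map proj₁ ps) x∈)
      unmarked : ∀ {x} → x ∉ map proj₁ ps → lookup (markFirsts ps) x ≡ false
      unmarked {x} x∉ = trans (lookup∘tabulate _ x) (dec-false (x ∈? map proj₁ ps) x∉)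

module _ {n : ℕ} (P : List (StrSet n)) (sp : StrSet n → Partition n) where

  SameQPart : Fin n → Fin n → Set
  SameQPart k l = All (λ C → sp C k ≡ sp C l) P

  sameQPart? : Decidable SameQPart
  sameQPart? k l = All.all? (λ C → sp C k ℕ.≟ sp C l) P

  SameQPart-sym : Symmetric SameQPart
  SameQPart-sym = All.map sym

  SameQPart-trans : Transitive SameQPart
  SameQPart-trans k~l l~m = All.zipWith (uncurry trans) (k~l , l~m)

  open GreedyMatching sameQPart? SameQPart-sym
  open Matching

  outsideS⇒HasPartner : ∀ {k} → inS P sp k ≡ false → HasPartner (allFin n) k
  outsideS⇒HasPartner {k} k∉S =
    partner (find (¬All⇒Any¬ (T? ∘ separated) (allFin n) (subst T k∉S ∘ all⁻ separated)))
    where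
      -- inS P sp k unfolds to all separated (allFin n)
      separated : Fin n → Bool
      separated l = (toℕ l ≡ᵇ toℕ k) ∨ not (sameQ P sp k l)
      partner : (∃ λ l → l ∈ allFin n × ¬ T (separated l)) → HasPartner (allFin n) k
      partner (l , l∈ , ¬separated) with toℕ l ≡ᵇ toℕ k in l≡ᵇk | sameQ P sp k l in k~l
      ... | true  | _     = contradiction tt ¬separated
      ... | false | false = contradiction tt ¬separated
      ... | false | true  = l , l∈ , l≢k , All.map (≡ᵇ⇒≡ _ _) (all⁺ _ P (subst T (sym k~l) tt))
        where
          l≢k : l ≢ k
          l≢k refl = subst T l≡ᵇk (≡⇒≡ᵇ (toℕ k) (toℕ k) refl)

  module _ (respects : ∀ C → C ∈ P → Respects C (sp C)) (covers : ∀ v → Any (λ C → C v ≡ true) P) where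

    private
      M = greedyMatching (allFin n)
      m = length (pairs M)

    cardNotS≤4*pairs : cardNotS P sp ≤ 4 * m
    cardNotS≤4*pairs = length-partnered≤4*pairs SameQPart-trans M
      (Unique.filter⁺ (T? ∘ not ∘ inS P sp) {allFin n} (Unique.allFin⁺ n))
      (λ {t} _ → ∈-allFin t)
      (λ t∈ → outsideS⇒HasPartner (Equivalence.to T-not-≡ (proj₂ (∈-filter⁻ (T? ∘ not ∘ inS P sp) {xs = allFin n} t∈))))

    2^pairs≤card : ∃ λ C → C ∈ P × 2 ^ m ≤ card C
    2^pairs≤card with C , C∈P , Cv ← find (covers (markFirsts (pairs M))) =
      C , C∈P , 2^length≤card E! (markFirsts-separates (pairs M) E!) (All.map stable (pairs-related M)) Cv
      where
        E! : Unique (endpoints (pairs M))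
        E! = Unique-++⁻ˡ (endpoints (pairs M)) (PermutationSetoid.Unique-resp-↭ (setoid (Fin n))
               (↭⇒↭ₛ (↭-sym (partition M))) (Unique.allFin⁺ n))
        stable : ∀ {ij} → uncurry SameQPart ij → StableUnderSwap C ij
        stable {i , j} i~j = respects C C∈P (transpose i j) (transpose-fixesParts (sp C) (All.lookup i~j C∈P))

    2^cardNotS≤card^4 : ∃ λ C → C ∈ P × 2 ^ cardNotS P sp ≤ card C ^ 4
    2^cardNotS≤card^4 with C , C∈P , 2^m≤|C| ← 2^pairs≤card = C , C∈P , (begin
      2 ^ cardNotS P sp ≤⟨ ^-monoʳ-≤ 2 cardNotS≤4*pairs ⟩
      2 ^ (4 * m)       ≡⟨ cong (2 ^_) (*-comm 4 m) ⟩
      2 ^ (m * 4)       ≡⟨ ^-*-assoc 2 m 4 ⟨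
      (2 ^ m) ^ 4       ≤⟨ ^-monoˡ-≤ 4 2^m≤|C| ⟩
      card C ^ 4        ∎)
      where open ≤-Reasoning

lemma18 : (P : (n : ℕ) → List (StrSet n))
          → (∀ n → IsOrderedPartition (P n))
          → (sp : (n : ℕ) → StrSet n → Partition n)
          → (∀ n C → C ∈ P n → IsSP C (sp n C))
          → (c : ℕ)
          → (∃ λ N → ∀ n → N ≤ n → ∀ C → C ∈ P n → card C ≤ c * n)
          → (∀ n (v : Str n) → Any (λ C → C v ≡ true) (P n))
          → ∃ λ N → ∀ n → N ≤ n → 2 ^ cardNotS (P n) (sp n) < n ^ 8
lemma18 P _ sp isSP c (N , small) covers = suc c ℕ.⊔ N , bound
  where
    bound : ∀ n → suc c ℕ.⊔ N ≤ n → 2 ^ cardNotS (P n) (sp n) < n ^ 8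
    bound n n≥
      with C , C∈P , 2^|T|≤|C|^4 ← 2^cardNotS≤card^4 (P n) (sp n) (λ C C∈ → proj₁ (isSP n C C∈)) (covers n) =
      begin-strict
        2 ^ cardNotS (P n) (sp n) ≤⟨ 2^|T|≤|C|^4 ⟩
        card C ^ 4                ≤⟨ ^-monoˡ-≤ 4 (small n (m⊔n≤o⇒n≤o (suc c) N n≥) C C∈P) ⟩
        (c * n) ^ 4               <⟨ ^-monoˡ-< 4 (*-monoˡ-< n {{>-nonZero (m<n⇒0<n c<n)}} c<n) ⟩
        (n * n) ^ 4               ≡⟨ cong (λ k → (n * k) ^ 4) (*-identityʳ n) ⟨
        (n ^ 2) ^ 4               ≡⟨ ^-*-assoc n 2 4 ⟩
        n ^ 8                     ∎
      where
        open ≤-Reasoning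
        c<n : c < n
        c<n = m⊔n≤o⇒m≤o (suc c) N n≥
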